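{- Let $\mathtt{At}$ be a countable set of atomic formulas and $\Phi_0$ the set of Boolean formulas over $\mathtt{At}$. The modal axiom schema $$\big(\neg B(\phi>\neg\psi)\wedge B(\phi>(\psi\rightarrow\chi))\big)\rightarrow B\big((\phi\wedge\psi)>(\psi\wedge\chi)\big)\qquad(\phi,\psi,\chi\in\Phi_0)$$ corresponds to the following property of Kripke-Lewis frames $\langle S,\mathcal B,f\rangle$: $(P\ast8)$: for all $s\in S$ and all $E,F\in 2^S\setminus\{\varnothing\}$, if there exists $\hat s\in\mathcal B(s)$ with $f(\hat s,E)\cap F\neq\varnothing$, then for every $s'\in\mathcal B(s)$, $$f(s',E\cap F)\subseteq\bigcup_{x\in\mathcal B(s)}\big(f(x,E)\cap F\big).$$ That is: (1) the schema is valid on every frame satisfying $(P\ast8)$, and (2) on every frame violating $(P\ast8)$ the schema is not valid.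
   Context: $\Phi_0$ is built from $\mathtt{At}$ using $\neg$ and $\vee$ (with $\rightarrow,\wedge,\leftrightarrow$ defined as usual). A Kripke-Lewis frame is a triple $\langle S,\mathcal B,f\rangle$ where $S$ is a set of states, $\mathcal B\subseteq S\times S$ is a serial relation, $\mathcal B(s)=\{s':s\mathcal Bs'\}$, and $f:S\times(2^S\setminus\{\varnothing\})\to 2^S$ is an arbitrary function (no further properties assumed; in particular $f(s',E\cap F)$ is only defined when $E\cap F\ne\varnothing$). A model is a frame together with a valuation $V:\mathtt{At}\to 2^S$. Truth at a state $s$: $s\models p$ iff $s\in V(p)$ for atoms; $\neg,\vee$ classical; $\Vert\phi\Vert=\{s:s\models\phi\}$. For $\phi\in\Phi_0$, $s\models\square\phi$ iff $\Vert\phi\Vert=S$. For $\phi,\psi\in\Phi_0$, $s\models\phi>\psi$ iff either $\Vert\phi\Vert=\varnothing$, or $\Vert\phi\Vert\neq\varnothing$ and $f(s,\Vert\phi\Vert)\subseteq\Vert\psi\Vert$. For $\phi$ a Boolean combination of formulas of $\Phi_0$ and conditionals $\alpha>\beta$ ($\alpha,\beta\in\Phi_0$), $s\models B\phi$ iff $\mathcal B(s)\subseteq\Vert\phi\Vert$. A schema is valid on a frame if every instance is true at every state of every model based on that frame. -}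

module Defs where

open import Data.Nat using (ℕ)
open import Data.Product using (Σ; ∃; _×_; _,_)
open import Data.Sum using (_⊎_)
open import Relation.Nullary using (¬_)
open import Function.Bundles using (_⇔_)

Pred₀ : Set → Set₁
Pred₀ S = S → Set

_⊆_ : {S : Set} → Pred₀ S → Pred₀ S → Set
E ⊆ F = ∀ x → E x → F x

_∩_ : {S : Set} → Pred₀ S → Pred₀ S → Pred₀ S
(E ∩ F) x = E x × F x

Nonempty : {S : Set} → Pred₀ S → Set
Nonempty {S} E = Σ S E

Empty : {S : Set} → Pred₀ S → Set
Empty E = ∀ x → ¬ E x

data Φ₀ : Set where
  atom : ℕ → Φ₀
  neg  : Φ₀ → Φ₀
  or   : Φ₀ → Φ₀ → Φ₀

and₀ : Φ₀ → Φ₀ → Φ₀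
and₀ φ ψ = neg (or (neg φ) (neg ψ))

imp₀ : Φ₀ → Φ₀ → Φ₀
imp₀ φ ψ = or (neg φ) ψ

data Φ₁ : Set where
  base : Φ₀ → Φ₁
  cond : Φ₀ → Φ₀ → Φ₁
  neg  : Φ₁ → Φ₁
  or   : Φ₁ → Φ₁ → Φ₁

data Φ₂ : Set where
  lift : Φ₁ → Φ₂
  box  : Φ₀ → Φ₂
  bel  : Φ₁ → Φ₂
  neg  : Φ₂ → Φ₂
  or   : Φ₂ → Φ₂ → Φ₂

and₂ : Φ₂ → Φ₂ → Φ₂
and₂ φ ψ = neg (or (neg φ) (neg ψ))

imp₂ : Φ₂ → Φ₂ → Φ₂
imp₂ φ ψ = or (neg φ) ψ

-- Kripke-Lewis frame.  f is total on all subsets; its values on ∅ are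
-- never used by the semantics.  Since subsets are represented by
-- predicates, f is required to respect extensional equality of subsets
-- (f is a function on 2^S).
record Frame : Set₁ where
  field
    S      : Set
    B      : S → S → Set
    serial : ∀ s → ∃ (B s)
    f      : S → Pred₀ S → Pred₀ S
    f-ext  : ∀ s (E E′ : Pred₀ S) → (∀ x → E x ⇔ E′ x) → ∀ y → f s E y ⇔ f s E′ y

module Semantics (Fr : Frame) (V : ℕ → Pred₀ (Frame.S Fr)) where
  open Frame Fr

  _⊨₀_ : S → Φ₀ → Set
  s ⊨₀ atom n = V n s
  s ⊨₀ neg φ  = ¬ (s ⊨₀ φ)
  s ⊨₀ or φ ψ = (s ⊨₀ φ) ⊎ (s ⊨₀ ψ)

  ‖_‖₀ : Φ₀ → Pred₀ S
  ‖ φ ‖₀ s = s ⊨₀ φ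

  _⊨₁_ : S → Φ₁ → Set
  s ⊨₁ base φ   = s ⊨₀ φ
  s ⊨₁ cond φ ψ = Empty ‖ φ ‖₀ ⊎ (Nonempty ‖ φ ‖₀ × (f s ‖ φ ‖₀ ⊆ ‖ ψ ‖₀))
  s ⊨₁ neg φ    = ¬ (s ⊨₁ φ)
  s ⊨₁ or φ ψ   = (s ⊨₁ φ) ⊎ (s ⊨₁ ψ)

  ‖_‖₁ : Φ₁ → Pred₀ S
  ‖ φ ‖₁ s = s ⊨₁ φ

  _⊨₂_ : S → Φ₂ → Set
  s ⊨₂ lift φ  = s ⊨₁ φ
  s ⊨₂ box φ   = ∀ x → x ⊨₀ φ
  s ⊨₂ bel φ   = B s ⊆ ‖ φ ‖₁
  s ⊨₂ neg φ   = ¬ (s ⊨₂ φ)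
  s ⊨₂ or φ ψ  = (s ⊨₂ φ) ⊎ (s ⊨₂ ψ)

schema : Φ₀ → Φ₀ → Φ₀ → Φ₂
schema φ ψ χ =
  imp₂ (and₂ (neg (bel (cond φ (neg ψ)))) (bel (cond φ (imp₀ ψ χ))))
       (bel (cond (and₀ φ ψ) (and₀ ψ χ)))

ValidSchema : Frame → Set₁
ValidSchema Fr = ∀ (V : ℕ → Pred₀ (Frame.S Fr)) (s : Frame.S Fr) (φ ψ χ : Φ₀) →
  Semantics._⊨₂_ Fr V s (schema φ ψ χ)

-- (P*8); the inclusion is only required when f(s', E ∩ F) is defined,
-- i.e. when E ∩ F ≠ ∅.
P*8 : Frame → Set₁
P*8 Fr = ∀ (s : S) (E F : Pred₀ S) → Nonempty E → Nonempty F →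
  (∃ λ ŝ → B s ŝ × Nonempty (f ŝ E ∩ F)) →
  Nonempty (E ∩ F) →
  ∀ s′ → B s s′ → f s′ (E ∩ F) ⊆ (λ y → ∃ λ x → B s x × (f x E ∩ F) y)
  where open Frame Fr

{-# OPTIONS --safe #-}
module Submission where

-- Everything is read off the truth sets E = ‖φ‖, F = ‖ψ‖, G = ‖χ‖.  At a
-- state s, the first premise of the schema provides some ŝ ∈ B(s) with
-- f(ŝ,E) ∩ F ≠ ∅, the second says f(x,E) ∩ F ⊆ G for every x ∈ B(s), and the
-- conclusion asks f(s′,E ∩ F) ⊆ F ∩ G for every s′ ∈ B(s); (P*8) bridges the
-- two.  Conversely, interpreting χ by G = ⋃_{x ∈ B(s)} f(x,E) ∩ F makes both
-- premises true, and the conclusion is then precisely (P*8).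

open import Defs
open import Level using (0ℓ)
open import Data.Nat using (ℕ)
open import Data.Product using (_×_; _,_; ∃; proj₂)
open import Data.Sum using (_⊎_; inj₁; inj₂; [_,_])
open import Data.Empty using (⊥-elim)
open import Relation.Nullary using (¬_; yes; no)
open import Relation.Unary using (∁; _∪_)
open import Axiom.ExcludedMiddle using (ExcludedMiddle)
open import Axiom.DoubleNegationElimination using (em⇒dne)
open import Function.Base using (_∘_; id)
open import Function.Bundles using (_⇔_; mk⇔; Equivalence)
open import Function.Construct.Symmetry using (⇔-sym)

open Equivalence using (to; from)

_≐_ : {S : Set} → Pred₀ S → Pred₀ S → Set
E ≐ F = ∀ x → E x ⇔ F x

module Classical (em : ExcludedMiddle 0ℓ) where

  ¬⊎⇔→ : {A B : Set} → (¬ A ⊎ B) ⇔ (A → B)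
  ¬⊎⇔→ {A} = mk⇔ (λ h a → [ (λ ¬a → ⊥-elim (¬a a)) , id ] h) from→
    where
    from→ : ∀ {B} → (A → B) → ¬ A ⊎ B
    from→ h with em {A}
    ... | yes a = inj₂ (h a)
    ... | no ¬a = inj₁ ¬a

  ¬[¬⊎¬]⇔× : {A B : Set} → (¬ (¬ A ⊎ ¬ B)) ⇔ (A × B)
  ¬[¬⊎¬]⇔× = mk⇔ (λ h → em⇒dne em (h ∘ inj₁) , em⇒dne em (h ∘ inj₂))
                 (λ (a , b) → [ (λ ¬a → ¬a a) , (λ ¬b → ¬b b) ])

  ¬Empty⇒Nonempty : {S : Set} {E : Pred₀ S} → ¬ Empty E → Nonempty E
  ¬Empty⇒Nonempty ¬empty = em⇒dne em λ ¬ne → ¬empty λ x e → ¬ne (x , e)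

  ¬⊆⇒∃∖ : {S : Set} {E F : Pred₀ S} → ¬ (E ⊆ F) → ∃ λ x → E x × ¬ F x
  ¬⊆⇒∃∖ ¬E⊆F = em⇒dne em λ ¬∃ →
    ¬E⊆F λ x e → em⇒dne em λ ¬f → ¬∃ (x , e , ¬f)

module Conditionals (Fr : Frame) where
  open Frame Fr

  infix 4 _⊩_⇒_

  _⊩_⇒_ : S → Pred₀ S → Pred₀ S → Set
  x ⊩ E ⇒ F = Empty E ⊎ (Nonempty E × f x E ⊆ F)

  ⊩-elim : ∀ {x E F} → Nonempty E → x ⊩ E ⇒ F → f x E ⊆ F
  ⊩-elim (w , e) (inj₁ empty)      = ⊥-elim (empty w e)
  ⊩-elim _       (inj₂ (_ , fE⊆F)) = fE⊆F

  ⊩-cong : ∀ {x E E′ F F′} → E ≐ E′ → F ⊆ F′ → x ⊩ E ⇒ F → x ⊩ E′ ⇒ F′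
  ⊩-cong E≐E′ _ (inj₁ empty) = inj₁ λ y e′ → empty y (from (E≐E′ y) e′)
  ⊩-cong {x} {E} {E′} E≐E′ F⊆F′ (inj₂ ((w , e) , fE⊆F)) =
    inj₂ ((w , to (E≐E′ w) e) , λ y fE′y → F⊆F′ y (fE⊆F y (from (f-ext x E E′ E≐E′ y) fE′y)))

  -- ‖¬ψ‖ is ∁ F and ‖ψ → χ‖ is ∁ F ∪ G on the nose; only ‖∧‖ = ∩ needs
  -- excluded middle.
  SchemaAt : S → (E F G : Pred₀ S) → Set
  SchemaAt s E F G =
    ¬ (B s ⊆ λ x → x ⊩ E ⇒ ∁ F) × (B s ⊆ λ x → x ⊩ E ⇒ ∁ F ∪ G) →
    B s ⊆ λ x → x ⊩ E ∩ F ⇒ F ∩ G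

  SchemaOnSets : Set₁
  SchemaOnSets = ∀ s E F G → SchemaAt s E F G

  module _ (em : ExcludedMiddle 0ℓ) where
    open Classical em

    P*8⇒SchemaOnSets : P*8 Fr → SchemaOnSets
    P*8⇒SchemaOnSets p*8 s E F G (¬B[E⇒∁F] , B[E⇒∁F∪G]) s′ Bss′
      with ¬⊆⇒∃∖ ¬B[E⇒∁F] | em {Nonempty (E ∩ F)}
    ... | _ | no ¬neEF = inj₁ λ y EFy → ¬neEF (y , EFy)
    ... | ŝ , Bsŝ , ŝ⊮E⇒∁F | yes neEF@(w , Ew , Fw) = inj₂ (neEF , fEF⊆FG)
      where
      neE : Nonempty E
      neE = ¬Empty⇒Nonempty λ empty → ŝ⊮E⇒∁F (inj₁ empty)

      fŝE∩F≠∅ : Nonempty (f ŝ E ∩ F)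
      fŝE∩F≠∅ with ¬⊆⇒∃∖ (λ fŝE⊆∁F → ŝ⊮E⇒∁F (inj₂ (neE , fŝE⊆∁F)))
      ... | y , fŝEy , ¬¬Fy = y , fŝEy , em⇒dne em ¬¬Fy

      fEF⊆FG : f s′ (E ∩ F) ⊆ (F ∩ G)
      fEF⊆FG y fEFy with p*8 s E F neE (w , Fw) (ŝ , Bsŝ , fŝE∩F≠∅) neEF s′ Bss′ y fEFy
      ... | x , Bsx , fxEy , Fy =
        Fy , [ (λ ¬Fy → ⊥-elim (¬Fy Fy)) , id ] (⊩-elim neE (B[E⇒∁F∪G] x Bsx) y fxEy)

    SchemaOnSets⇒P*8 : SchemaOnSets → P*8 Fr
    SchemaOnSets⇒P*8 schema s E F neE _ (ŝ , Bsŝ , (z , fŝEz , Fz)) neEF s′ Bss′ y fEFy =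
      proj₂ (⊩-elim neEF (schema s E F G (¬B[E⇒∁F] , B[E⇒∁F∪G]) s′ Bss′) y fEFy)
      where
      G : Pred₀ S
      G y = ∃ λ x → B s x × (f x E ∩ F) y

      ¬B[E⇒∁F] : ¬ (B s ⊆ λ x → x ⊩ E ⇒ ∁ F)
      ¬B[E⇒∁F] B[E⇒∁F] = ⊩-elim neE (B[E⇒∁F] ŝ Bsŝ) z fŝEz Fz

      B[E⇒∁F∪G] : B s ⊆ λ x → x ⊩ E ⇒ ∁ F ∪ G
      B[E⇒∁F∪G] x Bsx = inj₂ (neE , λ y fxEy → case-F y fxEy)
        where
        case-F : ∀ y → f x E y → (∁ F ∪ G) y
        case-F y fxEy with em {F y}
        ... | yes Fy = inj₂ (x , Bsx , fxEy , Fy)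
        ... | no ¬Fy = inj₁ ¬Fy

module FormulaSemantics (em : ExcludedMiddle 0ℓ) (Fr : Frame) (V : ℕ → Pred₀ (Frame.S Fr)) where
  open Frame Fr
  open Semantics Fr V
  open Conditionals Fr
  open Classical em

  and₀≐∩ : ∀ φ ψ → ‖ and₀ φ ψ ‖₀ ≐ (‖ φ ‖₀ ∩ ‖ ψ ‖₀)
  and₀≐∩ _ _ _ = ¬[¬⊎¬]⇔×

  ⊨schema⇔SchemaAt : ∀ s φ ψ χ → (s ⊨₂ schema φ ψ χ) ⇔ SchemaAt s ‖ φ ‖₀ ‖ ψ ‖₀ ‖ χ ‖₀
  ⊨schema⇔SchemaAt s φ ψ χ =
    mk⇔ (λ h premises → to conclusion (to ¬⊎⇔→ h (from ¬[¬⊎¬]⇔× premises)))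
        (λ h → from ¬⊎⇔→ λ premises → from conclusion (h (to ¬[¬⊎¬]⇔× premises)))
    where
    conclusion : B s ⊆ ‖ cond (and₀ φ ψ) (and₀ ψ χ) ‖₁ ⇔
                 (B s ⊆ λ x → x ⊩ ‖ φ ‖₀ ∩ ‖ ψ ‖₀ ⇒ ‖ ψ ‖₀ ∩ ‖ χ ‖₀)
    conclusion = mk⇔
      (λ h x Bsx → ⊩-cong (and₀≐∩ φ ψ) (λ y → to (and₀≐∩ ψ χ y)) (h x Bsx))
      (λ h x Bsx → ⊩-cong (λ y → ⇔-sym (and₀≐∩ φ ψ y)) (λ y → from (and₀≐∩ ψ χ y)) (h x Bsx))

atomsAs : {S : Set} → (E F G : Pred₀ S) → ℕ → Pred₀ S
atomsAs E _ _ 0 = E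
atomsAs _ F _ 1 = F
atomsAs _ _ G _ = G

module _ (em : ExcludedMiddle 0ℓ) (Fr : Frame) where
  open Conditionals Fr

  SchemaOnSets⇒ValidSchema : SchemaOnSets → ValidSchema Fr
  SchemaOnSets⇒ValidSchema schema V s φ ψ χ =
    from (FormulaSemantics.⊨schema⇔SchemaAt em Fr V s φ ψ χ) (schema s _ _ _)

  ValidSchema⇒SchemaOnSets : ValidSchema Fr → SchemaOnSets
  ValidSchema⇒SchemaOnSets valid s E F G =
    to (FormulaSemantics.⊨schema⇔SchemaAt em Fr (atomsAs E F G) s (atom 0) (atom 1) (atom 2))
       (valid (atomsAs E F G) s (atom 0) (atom 1) (atom 2))

proposition6 : ExcludedMiddle 0ℓ → (Fr : Frame) →
    (P*8 Fr → ValidSchema Fr) × (¬ P*8 Fr → ¬ ValidSchema Fr)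
proposition6 em Fr =
    (λ p*8 → SchemaOnSets⇒ValidSchema em Fr (P*8⇒SchemaOnSets em p*8))
  , (λ ¬p*8 valid → ¬p*8 (SchemaOnSets⇒P*8 em (ValidSchema⇒SchemaOnSets em Fr valid)))
  where open Conditionals Fr
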